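{- Let $\alpha(\mathsf{x})$ be a first-order formula with free variables among the sequence $\mathsf{x}$, and let $\mathsf{y}$ be a sequence of fresh variables with $|\mathsf{y}|=|\mathsf{x}|$. Then for every model $M$ and team $X$ of $M$ whose domain contains $\mathsf{x}$ (and not $\mathsf{y}$): $M\models_X\dot{\sim}\alpha(\mathsf{x})$ if and only if $M\models_X\exists\mathsf{y}(\mathsf{y}\subseteq\mathsf{x}\wedge\neg\alpha(\mathsf{y}/\mathsf{x}))$.
   Context: Team semantics: a team $X$ of $M$ is a set of assignments with common domain. $M\models_X\alpha$ (first-order) iff $M\models_s\alpha$ for all $s\in X$; $M\models_X\neg\alpha$ iff $M\not\models_s\alpha$ for all $s\in X$; $M\models_X\mathsf{y}\subseteq\mathsf{x}$ iff for every $s\in X$ there is $s'\in X$ with $s(\mathsf{y})=s'(\mathsf{x})$; $\wedge$ conjunctively; $M\models_X\exists y\phi$ iff $M\models_{X(F/y)}\phi$ for some $F:X\to\wp(M)\setminus\{\emptyset\}$, where $X(F/y)=\{s(a/y)\mid s\in X,a\in F(s)\}$ ($\exists\mathsf{y}$ is iterated). The weak classical negation $\dot{\sim}$ is defined by: $M\models_X\dot{\sim}\phi$ iff $X=\emptyset$ or $M\not\models_X\phi$. -}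

module Defs where

open import Data.Nat using (ℕ; _≟_)
open import Data.Vec using (Vec; []; _∷_; map)
open import Data.Product using (Σ; ∃; _×_; _,_)
open import Data.Sum using (_⊎_)
open import Data.Empty using (⊥)
open import Level using (Lift)
open import Relation.Nullary using (¬_; yes; no)
open import Relation.Binary.PropositionalEquality using (_≡_)

record Signature : Set₁ where
  field
    Fun : ℕ → Set
    Rel : ℕ → Set

module _ (σ : Signature) where
  open Signature σ

  data Term : Set where
    var : ℕ → Term
    app : ∀ {n} → Fun n → Vec Term n → Term

  data FO : Set where
    _≐_  : Term → Term → FO
    rel  : ∀ {n} → Rel n → Vec Term n → FO
    ¬ᶠ_  : FO → FO
    _∧ᶠ_ : FO → FO → FO
    _∨ᶠ_ : FO → FO → FO
    ∃ᶠ   : ℕ → FO → FO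
    ∀ᶠ   : ℕ → FO → FO

  mutual
    OccT : ℕ → Term → Set
    OccT v (var u) = v ≡ u
    OccT v (app f ts) = OccTs v ts

    OccTs : ∀ {n} → ℕ → Vec Term n → Set
    OccTs v [] = ⊥
    OccTs v (t ∷ ts) = OccT v t ⊎ OccTs v ts

  Free : ℕ → FO → Set
  Free v (t ≐ u) = OccT v t ⊎ OccT v u
  Free v (rel R ts) = OccTs v ts
  Free v (¬ᶠ φ) = Free v φ
  Free v (φ ∧ᶠ ψ) = Free v φ ⊎ Free v ψ
  Free v (φ ∨ᶠ ψ) = Free v φ ⊎ Free v ψ
  Free v (∃ᶠ u φ) = ¬ (v ≡ u) × Free v φ
  Free v (∀ᶠ u φ) = ¬ (v ≡ u) × Free v φ

  Occ : ℕ → FO → Set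
  Occ v (t ≐ u) = OccT v t ⊎ OccT v u
  Occ v (rel R ts) = OccTs v ts
  Occ v (¬ᶠ φ) = Occ v φ
  Occ v (φ ∧ᶠ ψ) = Occ v φ ⊎ Occ v ψ
  Occ v (φ ∨ᶠ ψ) = Occ v φ ⊎ Occ v ψ
  Occ v (∃ᶠ u φ) = v ≡ u ⊎ Occ v φ
  Occ v (∀ᶠ u φ) = v ≡ u ⊎ Occ v φ

  -- Renaming of free variables (used for α(y/x); capture cannot occur
  -- when the new variables do not occur in the formula)

  mutual
    renT : (ℕ → ℕ) → Term → Term
    renT ρ (var u) = var (ρ u)
    renT ρ (app f ts) = app f (renTs ρ ts)

    renTs : ∀ {n} → (ℕ → ℕ) → Vec Term n → Vec Term n
    renTs ρ [] = []
    renTs ρ (t ∷ ts) = renT ρ t ∷ renTs ρ ts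

  bindRen : (ℕ → ℕ) → ℕ → (ℕ → ℕ)
  bindRen ρ u v with v ≟ u
  ... | yes _ = u
  ... | no _ = ρ v

  ren : (ℕ → ℕ) → FO → FO
  ren ρ (t ≐ u) = renT ρ t ≐ renT ρ u
  ren ρ (rel R ts) = rel R (renTs ρ ts)
  ren ρ (¬ᶠ φ) = ¬ᶠ ren ρ φ
  ren ρ (φ ∧ᶠ ψ) = ren ρ φ ∧ᶠ ren ρ ψ
  ren ρ (φ ∨ᶠ ψ) = ren ρ φ ∨ᶠ ren ρ ψ
  ren ρ (∃ᶠ u φ) = ∃ᶠ u (ren (bindRen ρ u) φ)
  ren ρ (∀ᶠ u φ) = ∀ᶠ u (ren (bindRen ρ u) φ)

  swapVars : ∀ {n} → Vec ℕ n → Vec ℕ n → ℕ → ℕ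
  swapVars [] [] v = v
  swapVars (x ∷ xs) (y ∷ ys) v with v ≟ x
  ... | yes _ = y
  ... | no _ = swapVars xs ys v

  _[_/_] : ∀ {n} → FO → Vec ℕ n → Vec ℕ n → FO
  α [ ys / xs ] = ren (swapVars xs ys) α

  data TF : Set where
    fo   : FO → TF
    negᵗ : FO → TF
    incl : ∀ {k} → Vec ℕ k → Vec ℕ k → TF
    _∧ᵗ_ : TF → TF → TF
    ∃ᵗ   : ℕ → TF → TF
    ∼̇    : TF → TF

  ∃⃗ : ∀ {k} → Vec ℕ k → TF → TF
  ∃⃗ [] φ = φ
  ∃⃗ (y ∷ ys) φ = ∃ᵗ y (∃⃗ ys φ)

record Structure (σ : Signature) : Set₁ where
  open Signature σ
  field
    Carrier : Set
    funI    : ∀ {n} → Fun n → Vec Carrier n → Carrier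
    relI    : ∀ {n} → Rel n → Vec Carrier n → Set

module _ {σ : Signature} (M : Structure σ) where
  open Structure M

  Assignment : Set
  Assignment = ℕ → Carrier

  Team : Set₁
  Team = Assignment → Set

  update : Assignment → ℕ → Carrier → Assignment
  update s y a v with v ≟ y
  ... | yes _ = a
  ... | no _ = s v

  mutual
    evalT : Assignment → Term σ → Carrier
    evalT s (var u) = s u
    evalT s (app f ts) = funI f (evalTs s ts)

    evalTs : ∀ {n} → Assignment → Vec (Term σ) n → Vec Carrier n
    evalTs s [] = []
    evalTs s (t ∷ ts) = evalT s t ∷ evalTs s ts

  _⊨[_] : Assignment → FO σ → Set
  s ⊨[ t ≐ u ] = evalT s t ≡ evalT s u
  s ⊨[ rel R ts ] = relI R (evalTs s ts)
  s ⊨[ ¬ᶠ φ ] = ¬ (s ⊨[ φ ])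
  s ⊨[ φ ∧ᶠ ψ ] = (s ⊨[ φ ]) × (s ⊨[ ψ ])
  s ⊨[ φ ∨ᶠ ψ ] = (s ⊨[ φ ]) ⊎ (s ⊨[ ψ ])
  s ⊨[ ∃ᶠ u φ ] = ∃ λ a → update s u a ⊨[ φ ]
  s ⊨[ ∀ᶠ u φ ] = ∀ a → update s u a ⊨[ φ ]

  supplement : Team → (Assignment → Carrier → Set) → ℕ → Team
  supplement X F y s' =
    Σ Assignment λ s → X s × Σ Carrier λ a → F s a × (∀ v → s' v ≡ update s y a v)

  _⊨ᵀ[_] : Team → TF σ → Set₁
  X ⊨ᵀ[ fo α ] = Lift _ (∀ s → X s → s ⊨[ α ])
  X ⊨ᵀ[ negᵗ α ] = Lift _ (∀ s → X s → ¬ (s ⊨[ α ]))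
  X ⊨ᵀ[ incl ys xs ] = Lift _
    (∀ s → X s → Σ Assignment λ s' → X s' × (map s ys ≡ map s' xs))
  X ⊨ᵀ[ φ ∧ᵗ ψ ] = (X ⊨ᵀ[ φ ]) × (X ⊨ᵀ[ ψ ])
  X ⊨ᵀ[ ∃ᵗ y φ ] =
    Σ (Assignment → Carrier → Set) λ F →
      (∀ s → X s → ∃ λ a → F s a) × (supplement X F y ⊨ᵀ[ φ ])
  X ⊨ᵀ[ ∼̇ φ ] = (∀ s → ¬ X s) ⊎ ¬ (X ⊨ᵀ[ φ ])

-- If X ⊭ α, take a counterexample s₀ ∈ X and give ys the values s₀(xs) in every assignment. The
-- resulting team satisfies ys ⊆ xs, witnessed by the copy of s₀ whose xs are untouched, and ¬α(ys),
-- because α(ys) holds at an assignment exactly when α holds at s₀. Conversely, in a nonempty witness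
-- team ys ⊆ xs carries the ys-values of any member to the xs-values of a member, and these are the
-- xs-values of some s ∈ X; so X ⊨ α would give α(ys) at a member, contradicting ¬α(ys).
-- Excluded middle produces the counterexample and decides whether X is empty.
module Submission where

open import Defs
open import Data.Nat using (ℕ; _≟_)
open import Data.Fin using (zero; suc)
open import Data.Vec using (Vec; []; _∷_; map; lookup)
open import Data.Vec.Properties using (lookup-map)
open import Data.Vec.Membership.Propositional using (_∈_; _∉_)
open import Data.Vec.Membership.Propositional.Properties using (∈-lookup)
open import Data.Vec.Relation.Unary.Any using (here; there)
open import Data.Vec.Relation.Unary.All using (All; _∷_)
open import Data.Vec.Relation.Unary.AllPairs using (_∷_)
open import Data.Vec.Relation.Unary.Unique.Propositional using (Unique)
open import Data.Vec.Relation.Binary.Pointwise.Extensional using (ext; Pointwise-≡⇒≡)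
open import Data.Product using (∃; _×_; _,_; proj₁; proj₂)
open import Data.Product.Function.NonDependent.Propositional using (_×-⇔_)
open import Data.Sum using (_⊎_; inj₁; inj₂)
open import Data.Sum.Function.Propositional using (_⊎-⇔_)
open import Data.Empty using (⊥; ⊥-elim)
open import Level using (0ℓ; lift)
open import Relation.Nullary using (¬_; yes; no)
open import Relation.Binary.PropositionalEquality
open import Function.Base using (_∘_)
open import Function.Bundles using (_⇔_; mk⇔; Equivalence)
open import Function.Properties.Equivalence using () renaming (refl to ⇔-refl)
open import Function.Related.TypeIsomorphisms using (¬-cong-⇔)
open import Axiom.ExcludedMiddle using (ExcludedMiddle)

All≢⇒∉ : ∀ {n} {z : ℕ} {zs : Vec ℕ n} → All (z ≢_) zs → z ∉ zs
All≢⇒∉ (z≢w ∷ _) (here z≡w) = z≢w z≡w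
All≢⇒∉ (_ ∷ z≢zs) (there z∈zs) = All≢⇒∉ z≢zs z∈zs

≡⇒⇔ : ∀ {A B : Set} → A ≡ B → A ⇔ B
≡⇒⇔ refl = ⇔-refl

∃-cong-⇔ : ∀ {A : Set} {P Q : A → Set} → (∀ a → P a ⇔ Q a) → ∃ P ⇔ ∃ Q
∃-cong-⇔ P⇔Q = mk⇔ (λ (a , p) → a , Equivalence.to (P⇔Q a) p)
                   (λ (a , q) → a , Equivalence.from (P⇔Q a) q)

∀-cong-⇔ : ∀ {A : Set} {P Q : A → Set} → (∀ a → P a ⇔ Q a) → (∀ a → P a) ⇔ (∀ a → Q a)
∀-cong-⇔ P⇔Q = mk⇔ (λ p a → Equivalence.to (P⇔Q a) (p a))
                   (λ q a → Equivalence.from (P⇔Q a) (q a))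

module _ (σ : Signature) where

  CaptureAvoiding : (ℕ → ℕ) → FO σ → Set
  CaptureAvoiding ρ φ = ∀ w v → Occ σ w φ → ρ v ≡ w → v ≡ w

  bindRen-cases : ∀ ρ u v → (v ≡ u × bindRen σ ρ u v ≡ u) ⊎ (v ≢ u × bindRen σ ρ u v ≡ ρ v)
  bindRen-cases ρ u v with v ≟ u
  ... | yes v≡u = inj₁ (v≡u , refl)
  ... | no v≢u = inj₂ (v≢u , refl)

  bindRen-captureAvoiding : ∀ {ρ} u φ → CaptureAvoiding ρ φ → CaptureAvoiding (bindRen σ ρ u) φ
  bindRen-captureAvoiding {ρ} u φ avoids w v w∈φ ρ′v≡w with bindRen-cases ρ u v
  ... | inj₁ (refl , ρ′v≡v) = trans (sym ρ′v≡v) ρ′v≡w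
  ... | inj₂ (_ , ρ′v≡ρv) = avoids w v w∈φ (trans (sym ρ′v≡ρv) ρ′v≡w)

  swapVars-∈ : ∀ {n} (xs ys : Vec ℕ n) {v} → v ∈ xs →
    ∃ λ j → lookup xs j ≡ v × swapVars σ xs ys v ≡ lookup ys j
  swapVars-∈ (x ∷ xs) (y ∷ ys) {v} v∈xs with v ≟ x | v∈xs
  ... | yes v≡x | _ = zero , sym v≡x , refl
  ... | no v≢x | here v≡x = ⊥-elim (v≢x v≡x)
  ... | no _ | there v∈xs′ with swapVars-∈ xs ys v∈xs′
  ...   | j , xⱼ≡v , ρv≡yⱼ = suc j , xⱼ≡v , ρv≡yⱼ

  swapVars-fixed-or-∈ : ∀ {n} (xs ys : Vec ℕ n) v → swapVars σ xs ys v ≡ v ⊎ swapVars σ xs ys v ∈ ys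
  swapVars-fixed-or-∈ [] [] v = inj₁ refl
  swapVars-fixed-or-∈ (x ∷ xs) (y ∷ ys) v with v ≟ x
  ... | yes _ = inj₂ (here refl)
  ... | no _ with swapVars-fixed-or-∈ xs ys v
  ...   | inj₁ fixed = inj₁ fixed
  ...   | inj₂ ∈ys = inj₂ (there ∈ys)

  swapVars-captureAvoiding : ∀ {n} (xs ys : Vec ℕ n) φ →
    (∀ y → y ∈ ys → ¬ Occ σ y φ) → CaptureAvoiding (swapVars σ xs ys) φ
  swapVars-captureAvoiding xs ys φ ys∉φ w v w∈φ ρv≡w with swapVars-fixed-or-∈ xs ys v
  ... | inj₁ ρv≡v = trans (sym ρv≡v) ρv≡w
  ... | inj₂ ρv∈ys = ⊥-elim (ys∉φ w (subst (_∈ ys) ρv≡w ρv∈ys) w∈φ)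

module _ {σ : Signature} (M : Structure σ) where
  open Structure M

  private
    _⊨_ : Assignment M → FO σ → Set
    _⊨_ = _⊨[_] M

    _⊨ᵀ_ : Team M → TF σ → Set₁
    _⊨ᵀ_ = _⊨ᵀ[_] M

  update-same : ∀ s y a → update M s y a y ≡ a
  update-same s y a with y ≟ y
  ... | yes _ = refl
  ... | no y≢y = ⊥-elim (y≢y refl)

  update-other : ∀ s {y} a {v} → v ≢ y → update M s y a v ≡ s v
  update-other s {y} a {v} v≢y with v ≟ y
  ... | yes v≡y = ⊥-elim (v≢y v≡y)
  ... | no _ = refl

  update-cong : ∀ {s t} y a → s ≗ t → update M s y a ≗ update M t y a
  update-cong y a s≗t v with v ≟ y
  ... | yes _ = refl
  ... | no _ = s≗t v

  mutual
    evalT-renT : ∀ {s t} ρ τ → (∀ v → OccT σ v τ → s (ρ v) ≡ t v) →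
      evalT M s (renT σ ρ τ) ≡ evalT M t τ
    evalT-renT ρ (var u) agree = agree u refl
    evalT-renT ρ (app f τs) agree = cong (funI f) (evalTs-renTs ρ τs agree)

    evalTs-renTs : ∀ {s t k} ρ (τs : Vec (Term σ) k) → (∀ v → OccTs σ v τs → s (ρ v) ≡ t v) →
      evalTs M s (renTs σ ρ τs) ≡ evalTs M t τs
    evalTs-renTs ρ [] agree = refl
    evalTs-renTs ρ (τ ∷ τs) agree =
      cong₂ _∷_ (evalT-renT ρ τ (λ v → agree v ∘ inj₁)) (evalTs-renTs ρ τs (λ v → agree v ∘ inj₂))

  update-bindRen : ∀ {s t ρ} u a v → (ρ v ≡ u → v ≡ u) → (v ≢ u → s (ρ v) ≡ t v) →
    update M s u a (bindRen σ ρ u v) ≡ update M t u a v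
  update-bindRen {s} {t} {ρ} u a v ρv≡u⇒v≡u agree with bindRen-cases σ ρ u v
  ... | inj₁ (refl , ρ′v≡v) = begin
    update M s v a (bindRen σ ρ v v) ≡⟨ cong (update M s v a) ρ′v≡v ⟩
    update M s v a v                 ≡⟨ update-same s v a ⟩
    a                                ≡⟨ update-same t v a ⟨
    update M t v a v                 ∎
    where open ≡-Reasoning
  ... | inj₂ (v≢u , ρ′v≡ρv) = begin
    update M s u a (bindRen σ ρ u v) ≡⟨ cong (update M s u a) ρ′v≡ρv ⟩
    update M s u a (ρ v)             ≡⟨ update-other s a (v≢u ∘ ρv≡u⇒v≡u) ⟩
    s (ρ v)                          ≡⟨ agree v≢u ⟩
    t v                              ≡⟨ update-other t a v≢u ⟨
    update M t u a v                 ∎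
    where open ≡-Reasoning

  ren-sound : ∀ φ {s t ρ} → CaptureAvoiding σ ρ φ → (∀ v → Free σ v φ → s (ρ v) ≡ t v) →
    (s ⊨ ren σ ρ φ) ⇔ (t ⊨ φ)
  ren-sound (τ ≐ τ′) {ρ = ρ} avoids agree =
    ≡⇒⇔ (cong₂ _≡_ (evalT-renT ρ τ (λ v → agree v ∘ inj₁)) (evalT-renT ρ τ′ (λ v → agree v ∘ inj₂)))
  ren-sound (rel R τs) {ρ = ρ} avoids agree = ≡⇒⇔ (cong (relI R) (evalTs-renTs ρ τs agree))
  ren-sound (¬ᶠ φ) avoids agree = ¬-cong-⇔ (ren-sound φ avoids agree)
  ren-sound (φ ∧ᶠ ψ) avoids agree =
    ren-sound φ (λ w v → avoids w v ∘ inj₁) (λ v → agree v ∘ inj₁) ×-⇔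
    ren-sound ψ (λ w v → avoids w v ∘ inj₂) (λ v → agree v ∘ inj₂)
  ren-sound (φ ∨ᶠ ψ) avoids agree =
    ren-sound φ (λ w v → avoids w v ∘ inj₁) (λ v → agree v ∘ inj₁) ⊎-⇔
    ren-sound ψ (λ w v → avoids w v ∘ inj₂) (λ v → agree v ∘ inj₂)
  ren-sound (∃ᶠ u φ) avoids agree = ∃-cong-⇔ λ a →
    ren-sound φ (bindRen-captureAvoiding σ u φ (λ w v → avoids w v ∘ inj₂))
      (λ v v∈φ → update-bindRen u a v (avoids u v (inj₁ refl)) (λ v≢u → agree v (v≢u , v∈φ)))
  ren-sound (∀ᶠ u φ) avoids agree = ∀-cong-⇔ λ a →
    ren-sound φ (bindRen-captureAvoiding σ u φ (λ w v → avoids w v ∘ inj₂))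
      (λ v v∈φ → update-bindRen u a v (avoids u v (inj₁ refl)) (λ v≢u → agree v (v≢u , v∈φ)))

  [/]-sound : ∀ {k} {xs ys : Vec ℕ k} α → (∀ v → Free σ v α → v ∈ xs) → (∀ y → y ∈ ys → ¬ Occ σ y α) →
    ∀ {s′ s} → (∀ j → s′ (lookup ys j) ≡ s (lookup xs j)) → (s′ ⊨ _[_/_] σ α ys xs) ⇔ (s ⊨ α)
  [/]-sound {xs = xs} {ys} α free⊆xs ys∉α {s′} {s} yⱼ≡xⱼ =
    ren-sound α (swapVars-captureAvoiding σ xs ys α ys∉α) agree
    where
      agree : ∀ v → Free σ v α → s′ (swapVars σ xs ys v) ≡ s v
      agree v v∈α with swapVars-∈ σ xs ys (free⊆xs v v∈α)
      ... | j , xⱼ≡v , ρv≡yⱼ = begin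
        s′ (swapVars σ xs ys v) ≡⟨ cong s′ ρv≡yⱼ ⟩
        s′ (lookup ys j)        ≡⟨ yⱼ≡xⱼ j ⟩
        s (lookup xs j)         ≡⟨ cong s xⱼ≡v ⟩
        s v                     ∎
        where open ≡-Reasoning

  Empty : Team M → Set
  Empty X = ∀ s → ¬ X s

  Nonempty : Team M → Set
  Nonempty X = ∃ X

  updateAll : ∀ {k} → Assignment M → Vec ℕ k → Vec Carrier k → Assignment M
  updateAll s [] [] = s
  updateAll s (z ∷ zs) (a ∷ as) = updateAll (update M s z a) zs as

  updateAll-cong : ∀ {k} (zs : Vec ℕ k) as {s t} → s ≗ t → updateAll s zs as ≗ updateAll t zs as
  updateAll-cong [] [] s≗t = s≗t
  updateAll-cong (z ∷ zs) (a ∷ as) s≗t = updateAll-cong zs as (update-cong z a s≗t)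

  updateAll-∉ : ∀ {k} (zs : Vec ℕ k) as s {v} → v ∉ zs → updateAll s zs as v ≡ s v
  updateAll-∉ [] [] s v∉zs = refl
  updateAll-∉ (z ∷ zs) (a ∷ as) s v∉zs =
    trans (updateAll-∉ zs as (update M s z a) (v∉zs ∘ there)) (update-other s a (v∉zs ∘ here))

  updateAll-lookup : ∀ {k} {zs : Vec ℕ k} → Unique zs → ∀ as s j →
    updateAll s zs as (lookup zs j) ≡ lookup as j
  updateAll-lookup {zs = z ∷ zs} (z∉zs ∷ _) (a ∷ as) s zero =
    trans (updateAll-∉ zs as (update M s z a) (All≢⇒∉ z∉zs)) (update-same s z a)
  updateAll-lookup (_ ∷ zs-unique) (a ∷ as) s (suc j) = updateAll-lookup zs-unique as _ j

  record IsUpdateOf {k} (Y X : Team M) (zs : Vec ℕ k) (as : Vec Carrier k) : Set where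
    field
      sound    : ∀ s′ → Y s′ → ∃ λ s → X s × s′ ≗ updateAll s zs as
      complete : ∀ s → X s → ∃ λ s′ → Y s′ × s′ ≗ updateAll s zs as

  supplement-isUpdateOf : ∀ {k X Y z a} {zs : Vec ℕ k} {as} →
    IsUpdateOf Y (supplement M X (λ _ b → b ≡ a) z) zs as → IsUpdateOf Y X (z ∷ zs) (a ∷ as)
  supplement-isUpdateOf {z = z} {a} {zs} {as} Y≈X′ = record { sound = sound ; complete = complete }
    where
      open IsUpdateOf Y≈X′ renaming (sound to sound′; complete to complete′)
      sound : ∀ s′ → _ → ∃ λ s → _ × s′ ≗ updateAll (update M s z a) zs as
      sound s′ s′∈Y with sound′ s′ s′∈Y
      ... | s₁ , (s , s∈X , _ , refl , s₁≗s[a/z]) , s′≗s₁[as/zs] =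
        s , s∈X , λ v → trans (s′≗s₁[as/zs] v) (updateAll-cong zs as s₁≗s[a/z] v)
      complete : ∀ s → _ → ∃ λ s′ → _ × s′ ≗ updateAll (update M s z a) zs as
      complete s s∈X = complete′ (update M s z a) (s , s∈X , a , refl , λ _ → refl)

  ∃⃗-intro : ∀ {k} (zs : Vec ℕ k) as {X φ} → (∀ Y → IsUpdateOf Y X zs as → Y ⊨ᵀ φ) → X ⊨ᵀ ∃⃗ σ zs φ
  ∃⃗-intro [] [] {X} h =
    h X (record { sound = λ s s∈X → s , s∈X , λ _ → refl ; complete = λ s s∈X → s , s∈X , λ _ → refl })
  ∃⃗-intro (z ∷ zs) (a ∷ as) h =
    (λ _ b → b ≡ a) , (λ _ _ → a , refl) , ∃⃗-intro zs as (λ Y → h Y ∘ supplement-isUpdateOf)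

  ∃⃗-empty : ∀ {k} (zs : Vec ℕ k) {X φ} → Empty X → (∀ Y → Empty Y → Y ⊨ᵀ φ) → X ⊨ᵀ ∃⃗ σ zs φ
  ∃⃗-empty [] {X} X-empty h = h X X-empty
  ∃⃗-empty (z ∷ zs) X-empty h =
    (λ _ _ → ⊥) , (λ s → ⊥-elim ∘ X-empty s) , ∃⃗-empty zs (λ { _ (s , s∈X , _) → X-empty s s∈X }) h

  ∃⃗-elim : ∀ {k} (zs : Vec ℕ k) {X φ} → X ⊨ᵀ ∃⃗ σ zs φ →
    ∃ λ Y → Y ⊨ᵀ φ
          × (∀ s′ → Y s′ → ∃ λ s → X s × (∀ v → v ∉ zs → s′ v ≡ s v))
          × (Nonempty X → Nonempty Y)
  ∃⃗-elim [] {X} X⊨φ = X , X⊨φ , (λ s s∈X → s , s∈X , λ _ _ → refl) , (λ X≠∅ → X≠∅)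
  ∃⃗-elim (z ∷ zs) {X} (F , F-total , X[F/z]⊨∃⃗) with ∃⃗-elim zs X[F/z]⊨∃⃗
  ... | Y , Y⊨φ , Y-from-X[F/z] , Y≠∅ = Y , Y⊨φ , Y-from-X , Y≠∅ ∘ X[F/z]≠∅
    where
      Y-from-X : ∀ s′ → Y s′ → ∃ λ s → X s × (∀ v → v ∉ z ∷ zs → s′ v ≡ s v)
      Y-from-X s′ s′∈Y with Y-from-X[F/z] s′ s′∈Y
      ... | s₁ , (s , s∈X , b , _ , s₁≗s[b/z]) , s′≡s₁ =
        s , s∈X , λ v v∉ →
          trans (s′≡s₁ v (v∉ ∘ there)) (trans (s₁≗s[b/z] v) (update-other s b (v∉ ∘ here)))
      X[F/z]≠∅ : Nonempty X → Nonempty (supplement M X F z)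
      X[F/z]≠∅ (s , s∈X) with F-total s s∈X
      ... | b , b∈F = update M s z b , s , s∈X , b , b∈F , λ _ → refl

module _ (em : ExcludedMiddle 0ℓ) {σ : Signature} (M : Structure σ) where
  open Structure M

  private
    _⊨_ : Assignment M → FO σ → Set
    _⊨_ = _⊨[_] M

    _⊨ᵀ_ : Team M → TF σ → Set₁
    _⊨ᵀ_ = _⊨ᵀ[_] M

  counterexample : ∀ {X} α → ¬ (X ⊨ᵀ fo α) → ∃ λ s → X s × ¬ (s ⊨ α)
  counterexample {X} α X⊭α with em {∃ λ s → X s × ¬ (s ⊨ α)}
  ... | yes witness = witness
  ... | no no-witness = ⊥-elim (X⊭α (lift X⊨α))
    where
      X⊨α : ∀ s → X s → s ⊨ α
      X⊨α s s∈X with em {s ⊨ α}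
      ... | yes s⊨α = s⊨α
      ... | no s⊭α = ⊥-elim (no-witness (s , s∈X , s⊭α))

  module _ {n : ℕ} {xs ys : Vec ℕ n} {α : FO σ} (ys-unique : Unique ys)
           (free⊆xs : ∀ v → Free σ v α → v ∈ xs) (ys-fresh : ∀ y → y ∈ ys → ¬ Occ σ y α × y ∉ xs) where

    private
      α[ys/xs] : FO σ
      α[ys/xs] = _[_/_] σ α ys xs

      ys∉α : ∀ y → y ∈ ys → ¬ Occ σ y α
      ys∉α y = proj₁ ∘ ys-fresh y

      xⱼ∉ys : ∀ j → lookup xs j ∉ ys
      xⱼ∉ys j xⱼ∈ys = proj₂ (ys-fresh _ xⱼ∈ys) (∈-lookup j xs)

      ⊨α[ys/xs] : ∀ {s′ s} → (∀ j → s′ (lookup ys j) ≡ s (lookup xs j)) → (s′ ⊨ α[ys/xs]) ⇔ (s ⊨ α)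
      ⊨α[ys/xs] = [/]-sound M α free⊆xs ys∉α

      ys⊆xs∧¬α[ys/xs] : TF σ
      ys⊆xs∧¬α[ys/xs] = incl ys xs ∧ᵗ negᵗ α[ys/xs]

    counterexampleCopy⊨ys⊆xs∧¬α[ys/xs] : ∀ {X Y s₀} → X s₀ → ¬ (s₀ ⊨ α) →
      IsUpdateOf M Y X ys (map s₀ xs) → Y ⊨ᵀ ys⊆xs∧¬α[ys/xs]
    counterexampleCopy⊨ys⊆xs∧¬α[ys/xs] {X} {Y} {s₀} s₀∈X s₀⊭α Y≈X[s₀xs/ys] = lift inclusion , lift negation
      where
        open IsUpdateOf Y≈X[s₀xs/ys]
        open ≡-Reasoning

        ys-copy-s₀xs : ∀ {s′} → Y s′ → ∀ j → s′ (lookup ys j) ≡ s₀ (lookup xs j)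
        ys-copy-s₀xs {s′} s′∈Y j with sound s′ s′∈Y
        ... | s , _ , s′≗s[s₀xs/ys] = begin
          s′ (lookup ys j)                              ≡⟨ s′≗s[s₀xs/ys] _ ⟩
          updateAll M s ys (map s₀ xs) (lookup ys j)    ≡⟨ updateAll-lookup M ys-unique _ s j ⟩
          lookup (map s₀ xs) j                          ≡⟨ lookup-map j s₀ xs ⟩
          s₀ (lookup xs j)                              ∎

        inclusion : ∀ s′ → Y s′ → ∃ λ s″ → Y s″ × map s′ ys ≡ map s″ xs
        inclusion s′ s′∈Y with complete s₀ s₀∈X
        ... | s″ , s″∈Y , s″≗s₀[s₀xs/ys] = s″ , s″∈Y , Pointwise-≡⇒≡ (ext λ j → begin
          lookup (map s′ ys) j                          ≡⟨ lookup-map j s′ ys ⟩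
          s′ (lookup ys j)                              ≡⟨ ys-copy-s₀xs s′∈Y j ⟩
          s₀ (lookup xs j)                              ≡⟨ updateAll-∉ M ys _ s₀ (xⱼ∉ys j) ⟨
          updateAll M s₀ ys (map s₀ xs) (lookup xs j)   ≡⟨ s″≗s₀[s₀xs/ys] _ ⟨
          s″ (lookup xs j)                              ≡⟨ lookup-map j s″ xs ⟨
          lookup (map s″ xs) j                          ∎)

        negation : ∀ s′ → Y s′ → ¬ (s′ ⊨ α[ys/xs])
        negation s′ s′∈Y = s₀⊭α ∘ Equivalence.to (⊨α[ys/xs] (ys-copy-s₀xs s′∈Y))

    ∼̇fo⇒∃⃗ : ∀ X → X ⊨ᵀ ∼̇ (fo α) → X ⊨ᵀ ∃⃗ σ ys ys⊆xs∧¬α[ys/xs]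
    ∼̇fo⇒∃⃗ X (inj₁ X-empty) = ∃⃗-empty M ys X-empty
      λ Y Y-empty → lift (λ s → ⊥-elim ∘ Y-empty s) , lift (λ s → ⊥-elim ∘ Y-empty s)
    ∼̇fo⇒∃⃗ X (inj₂ X⊭α) with counterexample α X⊭α
    ... | s₀ , s₀∈X , s₀⊭α = ∃⃗-intro M ys (map s₀ xs) λ _ → counterexampleCopy⊨ys⊆xs∧¬α[ys/xs] s₀∈X s₀⊭α

    ∃⃗⇒∼̇fo : ∀ X → X ⊨ᵀ ∃⃗ σ ys ys⊆xs∧¬α[ys/xs] → X ⊨ᵀ ∼̇ (fo α)
    ∃⃗⇒∼̇fo X X⊨∃⃗ with em {Nonempty M X}
    ... | no X-empty = inj₁ λ s s∈X → X-empty (s , s∈X)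
    ... | yes X≠∅ with ∃⃗-elim M ys X⊨∃⃗
    ...   | Y , (lift inclusion , lift negation) , Y-from-X , Y≠∅ = inj₂ λ (lift X⊨α) → refute X⊨α (Y≠∅ X≠∅)
      where
        refute : (∀ s → X s → s ⊨ α) → Nonempty M Y → ⊥
        refute X⊨α (s₁ , s₁∈Y) with inclusion s₁ s₁∈Y
        ... | s₂ , s₂∈Y , s₁ys≡s₂xs with Y-from-X s₂ s₂∈Y
        ...   | s₃ , s₃∈X , s₂≗s₃ =
          negation s₁ s₁∈Y (Equivalence.from (⊨α[ys/xs] s₁ys≡s₃xs) (X⊨α s₃ s₃∈X))
          where
            open ≡-Reasoning
            s₁ys≡s₃xs : ∀ j → s₁ (lookup ys j) ≡ s₃ (lookup xs j)
            s₁ys≡s₃xs j = begin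
              s₁ (lookup ys j)      ≡⟨ lookup-map j s₁ ys ⟨
              lookup (map s₁ ys) j  ≡⟨ cong (λ w → lookup w j) s₁ys≡s₂xs ⟩
              lookup (map s₂ xs) j  ≡⟨ lookup-map j s₂ xs ⟩
              s₂ (lookup xs j)      ≡⟨ s₂≗s₃ _ (xⱼ∉ys j) ⟩
              s₃ (lookup xs j)      ∎

mainTheorem5 :
    ExcludedMiddle 0ℓ →
    (σ : Signature) (M : Structure σ) {n : ℕ} (xs ys : Vec ℕ n) (α : FO σ) →
    Unique xs → Unique ys →
    (∀ v → Free σ v α → v ∈ xs) →
    (∀ y → y ∈ ys → ¬ Occ σ y α × y ∉ xs) →
    (X : Team M) →
    (_⊨ᵀ[_] M X (∼̇ (fo α)))
      ⇔ (_⊨ᵀ[_] M X (∃⃗ σ ys (incl ys xs ∧ᵗ negᵗ (_[_/_] σ α ys xs))))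
mainTheorem5 em σ M xs ys α _ ys-unique free⊆xs ys-fresh X =
  mk⇔ (∼̇fo⇒∃⃗ em M ys-unique free⊆xs ys-fresh X) (∃⃗⇒∼̇fo em M ys-unique free⊆xs ys-fresh X)
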